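{- For each of the triplets $(e,12,12)$, $(e,12,123)$, $(e,12,132)$, $(e,13,123)$, $(e,13,132)$, $(e,23,12)$, $(e,23,123)$, $(e,23,132)$, $(e,123,12)$, $(e,123,123)$, $(e,123,132)$, the minimal terms of the TRIP-Stern tree lie on the left-most path: for every $n\ge0$, the minimum $b_n=\min_{|v|=n}\min_{i}b_i(v)$ is attained as an entry of $(1,1,1)F_0^n$.
   Context: Let $A_0=\begin{pmatrix}0&0&1\\1&0&0\\0&1&1\end{pmatrix}$, $A_1=\begin{pmatrix}1&0&1\\0&1&0\\0&0&1\end{pmatrix}$. Elements of $S_3$ are identified with permutation matrices: $e=I$, $(12)=\begin{pmatrix}0&1&0\\1&0&0\\0&0&1\end{pmatrix}$, $(13)=\begin{pmatrix}0&0&1\\0&1&0\\1&0&0\end{pmatrix}$, $(23)=\begin{pmatrix}1&0&0\\0&0&1\\0&1&0\end{pmatrix}$, $(123)=\begin{pmatrix}0&1&0\\0&0&1\\1&0&0\end{pmatrix}$, $(132)=\begin{pmatrix}0&0&1\\1&0&0\\0&1&0\end{pmatrix}$. For $(\sigma,\tau_0,\tau_1)\in S_3^3$ put $F_0=\sigma A_0\tau_0$, $F_1=\sigma A_1\tau_1$. For $v=(i_1,\dots,i_n)\in\{0,1\}^n$ let $\triangle(v)=(1,1,1)F_{i_1}\cdots F_{i_n}=(b_1(v),b_2(v),b_3(v))$; level $n$ of the TRIP-Stern tree consists of the $\triangle(v)$ with $|v|=n$, and the left-most node of level $n$ is $(1,1,1)F_0^n$. -}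

module Defs where

open import Data.Nat using (ℕ; zero; suc; _+_; _*_)
open import Data.Fin using (Fin; zero; suc)
open import Data.Bool using (Bool; true; false)
open import Data.Vec using (Vec; []; _∷_)
open import Data.List using (List; []; _∷_)
open import Data.Product using (_×_; _,_)

Mat3 : Set
Mat3 = Fin 3 → Fin 3 → ℕ

Row3 : Set
Row3 = Fin 3 → ℕ

mat : ℕ → ℕ → ℕ → ℕ → ℕ → ℕ → ℕ → ℕ → ℕ → Mat3
mat a b c d e f g h i zero zero = a
mat a b c d e f g h i zero (suc zero) = b
mat a b c d e f g h i zero (suc (suc zero)) = c
mat a b c d e f g h i (suc zero) zero = d
mat a b c d e f g h i (suc zero) (suc zero) = e
mat a b c d e f g h i (suc zero) (suc (suc zero)) = f
mat a b c d e f g h i (suc (suc zero)) zero = g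
mat a b c d e f g h i (suc (suc zero)) (suc zero) = h
mat a b c d e f g h i (suc (suc zero)) (suc (suc zero)) = i

sum3 : (Fin 3 → ℕ) → ℕ
sum3 f = f zero + f (suc zero) + f (suc (suc zero))

_⊗_ : Mat3 → Mat3 → Mat3
(A ⊗ B) i k = sum3 (λ j → A i j * B j k)

_⊙_ : Row3 → Mat3 → Row3
(x ⊙ A) k = sum3 (λ j → x j * A j k)

ones : Row3
ones _ = 1

A₀ : Mat3
A₀ = mat 0 0 1
         1 0 0
         0 1 1

A₁ : Mat3
A₁ = mat 1 0 1
         0 1 0
         0 0 1

data S3 : Set where
  e p12 p13 p23 p123 p132 : S3

perm : S3 → Mat3
perm e    = mat 1 0 0  0 1 0  0 0 1
perm p12  = mat 0 1 0  1 0 0  0 0 1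
perm p13  = mat 0 0 1  0 1 0  1 0 0
perm p23  = mat 1 0 0  0 0 1  0 1 0
perm p123 = mat 0 1 0  0 0 1  1 0 0
perm p132 = mat 0 0 1  1 0 0  0 1 0

Triplet : Set
Triplet = S3 × S3 × S3

F : Triplet → Bool → Mat3
F (σ , τ₀ , τ₁) false = (perm σ ⊗ A₀) ⊗ perm τ₀
F (σ , τ₀ , τ₁) true  = (perm σ ⊗ A₁) ⊗ perm τ₁

applyWord : Triplet → {n : ℕ} → Row3 → Vec Bool n → Row3
applyWord t x []       = x
applyWord t x (b ∷ bs) = applyWord t (x ⊙ F t b) bs

-- △(v) = (1,1,1) F_{i₁} ⋯ F_{iₙ} ; false ↔ 0, true ↔ 1
node : Triplet → {n : ℕ} → Vec Bool n → Row3
node t v = applyWord t ones v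

zeros : (n : ℕ) → Vec Bool n
zeros zero    = []
zeros (suc n) = false ∷ zeros n

theorem16Triplets : List Triplet
theorem16Triplets =
  (e , p12 , p12) ∷ (e , p12 , p123) ∷ (e , p12 , p132) ∷
  (e , p13 , p123) ∷ (e , p13 , p132) ∷
  (e , p23 , p12) ∷ (e , p23 , p123) ∷ (e , p23 , p132) ∷
  (e , p123 , p12) ∷ (e , p123 , p123) ∷ (e , p123 , p132) ∷ []

-- Every node of the tree has all entries ≥ 1: (1,1,1) does, and multiplying a positive row by a
-- matrix without zero columns keeps it positive; σ, τ and A₀, A₁ have no zero column, hence
-- neither do F₀ and F₁. For each listed triplet, F₀ has either a column k equal to e_k, or two
-- columns k, l equal to e_l and e_k. In both cases the entries k and l of (1,1,1)F₀ⁿ stay equal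
-- to 1, so 1 is the minimum and it is attained on the left-most path.
module Submission where

open import Defs
open import Data.Nat using (ℕ; _≤_; _≤?_; zero; suc; _+_; _*_; z≤n; s≤s)
open import Data.Nat.Properties
  using (≤-trans; ≤-reflexive; +-mono-≤; *-monoˡ-≤; *-assoc; *-distribˡ-+; *-distribʳ-+)
  renaming (_≟_ to _≟ℕ_)
open import Data.Nat.Tactic.RingSolver using (solve-∀)
open import Data.Fin using (Fin; zero; suc)
open import Data.Fin.Properties using (_≟_; all?)
open import Data.Bool using (Bool; true; false; if_then_else_)
open import Data.Vec using (Vec; []; _∷_)
open import Data.Product using (∃-syntax; _×_; _,_; proj₁)
open import Data.List.Membership.Propositional using (_∈_)
open import Data.List.Relation.Unary.All as All using (All; []; _∷_)
open import Relation.Nullary.Decidable using (Dec; True; does; from-yes; toWitness)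
open import Relation.Binary.PropositionalEquality using (_≡_; refl; sym; trans; cong; cong₂)
open Relation.Binary.PropositionalEquality.≡-Reasoning

sum3-cong : {f g : Fin 3 → ℕ} → (∀ i → f i ≡ g i) → sum3 f ≡ sum3 g
sum3-cong f≡g = cong₂ _+_ (cong₂ _+_ (f≡g zero) (f≡g (suc zero))) (f≡g (suc (suc zero)))

sum3-mono-≤ : {f g : Fin 3 → ℕ} → (∀ i → f i ≤ g i) → sum3 f ≤ sum3 g
sum3-mono-≤ f≤g = +-mono-≤ (+-mono-≤ (f≤g zero) (f≤g (suc zero))) (f≤g (suc (suc zero)))

*-distribˡ-sum3 : ∀ c (f : Fin 3 → ℕ) → c * sum3 f ≡ sum3 (λ i → c * f i)
*-distribˡ-sum3 c f = trans (*-distribˡ-+ c (f zero + f (suc zero)) (f (suc (suc zero))))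
                             (cong (_+ c * f (suc (suc zero))) (*-distribˡ-+ c (f zero) (f (suc zero))))

*-distribʳ-sum3 : ∀ c (f : Fin 3 → ℕ) → sum3 f * c ≡ sum3 (λ i → f i * c)
*-distribʳ-sum3 c f = trans (*-distribʳ-+ c (f zero + f (suc zero)) (f (suc (suc zero))))
                             (cong (_+ f (suc (suc zero)) * c) (*-distribʳ-+ c (f zero) (f (suc zero))))

sum3-comm : (g : Fin 3 → Fin 3 → ℕ) → sum3 (λ i → sum3 (g i)) ≡ sum3 (λ j → sum3 (λ i → g i j))
sum3-comm g = regroup (g zero zero) (g zero (suc zero)) (g zero (suc (suc zero)))
                      (g (suc zero) zero) (g (suc zero) (suc zero)) (g (suc zero) (suc (suc zero)))
                      (g (suc (suc zero)) zero) (g (suc (suc zero)) (suc zero))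
                      (g (suc (suc zero)) (suc (suc zero)))
  where
  regroup : ∀ a b c d e f g h i →
    (a + b + c) + (d + e + f) + (g + h + i) ≡ (a + d + g) + (b + e + h) + (c + f + i)
  regroup = solve-∀

⊙-⊗-assoc : ∀ x B C k → (x ⊙ (B ⊗ C)) k ≡ ((x ⊙ B) ⊙ C) k
⊙-⊗-assoc x B C k = begin
  sum3 (λ j → x j * sum3 (λ l → B j l * C l k))
    ≡⟨ sum3-cong (λ j → *-distribˡ-sum3 (x j) (λ l → B j l * C l k)) ⟩
  sum3 (λ j → sum3 (λ l → x j * (B j l * C l k)))
    ≡⟨ sum3-cong (λ j → sum3-cong (λ l → sym (*-assoc (x j) (B j l) (C l k)))) ⟩
  sum3 (λ j → sum3 (λ l → x j * B j l * C l k))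
    ≡⟨ sum3-comm (λ j l → x j * B j l * C l k) ⟩
  sum3 (λ l → sum3 (λ j → x j * B j l * C l k))
    ≡⟨ sum3-cong (λ l → sym (*-distribʳ-sum3 (C l k) (λ j → x j * B j l))) ⟩
  sum3 (λ l → sum3 (λ j → x j * B j l) * C l k)
    ∎

infix 4 _≤ʳ_

_≤ʳ_ : Row3 → Row3 → Set
x ≤ʳ y = ∀ j → x j ≤ y j

⊙-monoˡ-≤ : ∀ {x y} A → x ≤ʳ y → x ⊙ A ≤ʳ y ⊙ A
⊙-monoˡ-≤ A x≤y k = sum3-mono-≤ (λ j → *-monoˡ-≤ (A j k) (x≤y j))

NoZeroColumn : Mat3 → Set
NoZeroColumn A = ones ≤ʳ ones ⊙ A

noZeroColumn? : (A : Mat3) → Dec (NoZeroColumn A)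
noZeroColumn? A = all? (λ k → 1 ≤? (ones ⊙ A) k)

⊙-positive : ∀ {x} A → NoZeroColumn A → ones ≤ʳ x → ones ≤ʳ x ⊙ A
⊙-positive A noZero 1≤x k = ≤-trans (noZero k) (⊙-monoˡ-≤ A 1≤x k)

⊗-noZeroColumn : ∀ B C → NoZeroColumn B → NoZeroColumn C → NoZeroColumn (B ⊗ C)
⊗-noZeroColumn B C noZeroB noZeroC k =
  ≤-trans (⊙-positive C noZeroC noZeroB k) (≤-reflexive (sym (⊙-⊗-assoc ones B C k)))

perm-noZeroColumn : ∀ σ → NoZeroColumn (perm σ)
perm-noZeroColumn e    = from-yes (noZeroColumn? (perm e))
perm-noZeroColumn p12  = from-yes (noZeroColumn? (perm p12))
perm-noZeroColumn p13  = from-yes (noZeroColumn? (perm p13))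
perm-noZeroColumn p23  = from-yes (noZeroColumn? (perm p23))
perm-noZeroColumn p123 = from-yes (noZeroColumn? (perm p123))
perm-noZeroColumn p132 = from-yes (noZeroColumn? (perm p132))

permuted-noZeroColumn : ∀ σ A τ → NoZeroColumn A → NoZeroColumn ((perm σ ⊗ A) ⊗ perm τ)
permuted-noZeroColumn σ A τ noZeroA =
  ⊗-noZeroColumn (perm σ ⊗ A) (perm τ)
    (⊗-noZeroColumn (perm σ) A (perm-noZeroColumn σ) noZeroA) (perm-noZeroColumn τ)

F-noZeroColumn : ∀ t b → NoZeroColumn (F t b)
F-noZeroColumn (σ , τ₀ , τ₁) false = permuted-noZeroColumn σ A₀ τ₀ (from-yes (noZeroColumn? A₀))
F-noZeroColumn (σ , τ₀ , τ₁) true  = permuted-noZeroColumn σ A₁ τ₁ (from-yes (noZeroColumn? A₁))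

applyWord-positive : ∀ t {n} {x} (v : Vec Bool n) → ones ≤ʳ x → ones ≤ʳ applyWord t x v
applyWord-positive t []      1≤x = 1≤x
applyWord-positive t (b ∷ v) 1≤x = applyWord-positive t v (⊙-positive (F t b) (F-noZeroColumn t b) 1≤x)

node-positive : ∀ t {n} (v : Vec Bool n) → ones ≤ʳ node t v
node-positive t v = applyWord-positive t v (λ _ → s≤s z≤n)

δ : Fin 3 → Row3
δ j i = if does (j ≟ i) then 1 else 0

sum3-*δ : ∀ (x : Row3) j → sum3 (λ i → x i * δ j i) ≡ x j
sum3-*δ x zero             = first (x zero) (x (suc zero)) (x (suc (suc zero)))
  where first : ∀ a b c → a * 1 + b * 0 + c * 0 ≡ a
        first = solve-∀
sum3-*δ x (suc zero)       = second (x zero) (x (suc zero)) (x (suc (suc zero)))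
  where second : ∀ a b c → a * 0 + b * 1 + c * 0 ≡ b
        second = solve-∀
sum3-*δ x (suc (suc zero)) = third (x zero) (x (suc zero)) (x (suc (suc zero)))
  where third : ∀ a b c → a * 0 + b * 0 + c * 1 ≡ c
        third = solve-∀

UnitColumn : Mat3 → Fin 3 → Fin 3 → Set
UnitColumn A k j = ∀ i → A i k ≡ δ j i

unitColumn? : ∀ A k j → Dec (UnitColumn A k j)
unitColumn? A k j = all? (λ i → A i k ≟ℕ δ j i)

⊙-unitColumn : ∀ A {k j} → UnitColumn A k j → ∀ x → (x ⊙ A) k ≡ x j
⊙-unitColumn A unit x = trans (sum3-cong (λ i → cong (x i *_) (unit i))) (sum3-*δ x _)

-- k = l is allowed: then column k of F₀ is e_k.
leftmost-pinned : ∀ t {k l} → UnitColumn (F t false) k l → UnitColumn (F t false) l k →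
  ∀ n {x} → x k ≡ 1 → x l ≡ 1 → applyWord t x (zeros n) k ≡ 1 × applyWord t x (zeros n) l ≡ 1
leftmost-pinned t unitₖ unitₗ zero    xₖ≡1 xₗ≡1 = xₖ≡1 , xₗ≡1
leftmost-pinned t unitₖ unitₗ (suc n) {x} xₖ≡1 xₗ≡1 =
  leftmost-pinned t unitₖ unitₗ n (trans (⊙-unitColumn (F t false) unitₖ x) xₗ≡1)
                                  (trans (⊙-unitColumn (F t false) unitₗ x) xₖ≡1)

LeftmostPinned : Triplet → Set
LeftmostPinned t = ∃[ i ] ∀ n → node t (zeros n) i ≡ 1

pinned : ∀ {t} k l → {True (unitColumn? (F t false) k l)} → {True (unitColumn? (F t false) l k)} →
  LeftmostPinned t
pinned {t} k l {unitₖ} {unitₗ} = k , λ n → proj₁ (leftmost-pinned t {k} {l}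
  (toWitness {a? = unitColumn? (F t false) k l} unitₖ)
  (toWitness {a? = unitColumn? (F t false) l k} unitₗ) n refl refl)

theorem16Triplets-pinned : All LeftmostPinned theorem16Triplets
theorem16Triplets-pinned =
  pinned 𝟙 𝟙 ∷ pinned 𝟙 𝟙 ∷ pinned 𝟙 𝟙 ∷
  pinned 𝟙 𝟚 ∷ pinned 𝟙 𝟚 ∷
  pinned 𝟚 𝟚 ∷ pinned 𝟚 𝟚 ∷ pinned 𝟚 𝟚 ∷
  pinned 𝟙 𝟙 ∷ pinned 𝟙 𝟙 ∷ pinned 𝟙 𝟙 ∷ []
  where
  𝟙 𝟚 : Fin 3
  𝟙 = suc zero
  𝟚 = suc (suc zero)

theorem16 : (t : Triplet) → t ∈ theorem16Triplets → (n : ℕ) →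
    ∃[ i ] ((v : Vec Bool n) → (j : Fin 3) → node t (zeros n) i ≤ node t v j)
theorem16 t t∈ n =
  let i , leftmost≡1 = All.lookup theorem16Triplets-pinned t∈
  in  i , λ v j → ≤-trans (≤-reflexive (leftmost≡1 n)) (node-positive t v j)
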